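{- Let $S=\langle d_0,d_1,d_2,d_3\rangle$ be a numerical semigroup with embedding dimension four, and let $P=(\mu_1,\mu_2,\mu_3)\in\mathbb Z^3$ satisfy $\mu_1d_1+\mu_2d_2+\mu_3d_3=\mu d_0$ for some positive integer $\mu$. Then deleting from the initial collection of cubes all cubes $[[i,j,k]]$ with $i\ge\mu_1$, $j\ge\mu_2$, $k\ge\mu_3$ removes no cube whose label lies in $\mathrm{Ap}(S,d_0)$.
   Context: $S$ is the set of nonnegative integer combinations of its minimal generators $d_0,\dots,d_3$ ($\gcd=1$); $\mathrm{Ap}(S,d_0)=\{s\in S:s-d_0\notin S\}$. For $(i,j,k)\in\mathbb N^3$ the cube $[[i,j,k]]=[i,i+1]\times[j,j+1]\times[k,k+1]$ is labeled $id_1+jd_2+kd_3$; the initial collection of cubes consists of all such labeled cubes. (The deleted cubes are those meeting the region $\{x>\mu_1,y>\mu_2,z>\mu_3\}$ associated to $P$.) -}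

module Defs where

open import Data.Nat using (ℕ; _+_; _*_)
open import Data.Nat.GCD using (gcd)
open import Data.Integer using (ℤ; +_; _-_)
open import Data.Fin using (Fin; zero; suc)
open import Data.Product using (Σ; _×_)
open import Relation.Binary.PropositionalEquality using (_≡_)
open import Relation.Nullary using (¬_)

Gens : Set
Gens = Fin 4 → ℕ

comb : Gens → (Fin 4 → ℕ) → ℕ
comb d c = c zero * d zero + c (suc zero) * d (suc zero)
         + c (suc (suc zero)) * d (suc (suc zero))
         + c (suc (suc (suc zero))) * d (suc (suc (suc zero)))

InS : Gens → ℤ → Set
InS d s = Σ (Fin 4 → ℕ) λ c → s ≡ + comb d c

MinimalGens : Gens → Set
MinimalGens d = (i : Fin 4) → ¬ (Σ (Fin 4 → ℕ) λ c → (c i ≡ 0) × (d i ≡ comb d c))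

gcd4 : Gens → ℕ
gcd4 d = gcd (gcd (gcd (d zero) (d (suc zero))) (d (suc (suc zero)))) (d (suc (suc (suc zero))))

InAp : Gens → ℤ → Set
InAp d s = InS d s × ¬ InS d (s - + d zero)

-- label of the cube [[i,j,k]] : i d₁ + j d₂ + k d₃
label : Gens → ℕ → ℕ → ℕ → ℕ
label d i j k = i * d (suc zero) + j * d (suc (suc zero)) + k * d (suc (suc (suc zero)))

module Submission where

-- If μ₁d₁ + μ₂d₂ + μ₃d₃ = μd₀ with μ ≥ 1 and (i,j,k) ≥ (μ₁,μ₂,μ₃), then
--   id₁ + jd₂ + kd₃ − d₀ = (μ − 1)d₀ + (i − μ₁)d₁ + (j − μ₂)d₂ + (k − μ₃)d₃
-- has nonnegative coefficients, so it lies in S and the label is not in Ap(S, d₀).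

open import Defs
open import Data.Nat using (ℕ; zero; suc)
import Data.Nat as ℕ
open import Data.Integer using (ℤ; +_; _+_; _-_; _*_; _≤_; ∣_∣; +≤+)
open import Data.Integer.Properties
  using (pos-+; pos-*; 0≤i⇒+∣i∣≡i; i≤j⇒0≤j-i; +-inverseʳ; +-identityʳ)
open import Data.Integer.Tactic.RingSolver using (solve-∀)
open import Data.Fin using (Fin; zero; suc)
open import Data.Vec.Functional using (_∷_; [])
open import Data.Product using (_,_)
open import Relation.Binary.PropositionalEquality
  using (_≡_; sym; trans; cong; cong₂; subst; module ≡-Reasoning)
open import Relation.Nullary using (¬_)

pos-+*-cong : ∀ {a : ℕ} {a′ : ℤ} b x → + a ≡ a′ → + (a ℕ.+ b ℕ.* x) ≡ a′ + + b * + x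
pos-+*-cong {a} b x a≡a′ = trans (pos-+ a (b ℕ.* x)) (cong₂ _+_ a≡a′ (pos-* b x))

shift-by-relation : ∀ (m d₀ d₁ d₂ d₃ x y z μ₁ μ₂ μ₃ : ℤ) →
  μ₁ * d₁ + μ₂ * d₂ + μ₃ * d₃ ≡ (+ 1 + m) * d₀ →
  m * d₀ + (x - μ₁) * d₁ + (y - μ₂) * d₂ + (z - μ₃) * d₃ ≡ x * d₁ + y * d₂ + z * d₃ - d₀
shift-by-relation m d₀ d₁ d₂ d₃ x y z μ₁ μ₂ μ₃ relation = begin
  m * d₀ + (x - μ₁) * d₁ + (y - μ₂) * d₂ + (z - μ₃) * d₃
    ≡⟨ regroup m d₀ d₁ d₂ d₃ x y z μ₁ μ₂ μ₃ ⟩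
  label-d₀ + ((+ 1 + m) * d₀ - (μ₁ * d₁ + μ₂ * d₂ + μ₃ * d₃))
    ≡⟨ cong (λ r → label-d₀ + ((+ 1 + m) * d₀ - r)) relation ⟩
  label-d₀ + ((+ 1 + m) * d₀ - (+ 1 + m) * d₀)
    ≡⟨ cong (_+_ label-d₀) (+-inverseʳ ((+ 1 + m) * d₀)) ⟩
  label-d₀ + + 0
    ≡⟨ +-identityʳ label-d₀ ⟩
  label-d₀ ∎
  where
  open ≡-Reasoning
  label-d₀ : ℤ
  label-d₀ = x * d₁ + y * d₂ + z * d₃ - d₀
  regroup : ∀ (m d₀ d₁ d₂ d₃ x y z μ₁ μ₂ μ₃ : ℤ) →
    m * d₀ + (x - μ₁) * d₁ + (y - μ₂) * d₂ + (z - μ₃) * d₃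
    ≡ (x * d₁ + y * d₂ + z * d₃ - d₀) + ((+ 1 + m) * d₀ - (μ₁ * d₁ + μ₂ * d₂ + μ₃ * d₃))
  regroup = solve-∀

module _ (d : Gens) where

  private
    d₀ d₁ d₂ d₃ : ℕ
    d₀ = d zero
    d₁ = d (suc zero)
    d₂ = d (suc (suc zero))
    d₃ = d (suc (suc (suc zero)))

  combℤ : (Fin 4 → ℤ) → ℤ
  combℤ c = c zero * + d₀ + c (suc zero) * + d₁
          + c (suc (suc zero)) * + d₂ + c (suc (suc (suc zero))) * + d₃

  combℤ-cong : ∀ {c c′ : Fin 4 → ℤ} → (∀ t → c t ≡ c′ t) → combℤ c ≡ combℤ c′
  combℤ-cong {c} {c′} c≡c′ =
    cong₂ _+_ (cong₂ _+_ (cong₂ _+_ (scale zero d₀) (scale (suc zero) d₁))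
                         (scale (suc (suc zero)) d₂))
              (scale (suc (suc (suc zero))) d₃)
    where
    scale : ∀ t n → c t * + n ≡ c′ t * + n
    scale t n = cong (_* + n) (c≡c′ t)

  pos-comb : ∀ c → + comb d c ≡ combℤ (λ t → + c t)
  pos-comb c =
    pos-+*-cong (c (suc (suc (suc zero)))) d₃
      (pos-+*-cong (c (suc (suc zero))) d₂
        (pos-+*-cong (c (suc zero)) d₁ (pos-* (c zero) d₀)))

  pos-label : ∀ i j k → + label d i j k ≡ + i * + d₁ + + j * + d₂ + + k * + d₃
  pos-label i j k = pos-+*-cong k d₃ (pos-+*-cong j d₂ (pos-* i d₁))

  combℤ-nonneg-InS : ∀ (c : Fin 4 → ℤ) → (∀ t → + 0 ≤ c t) → InS d (combℤ c)
  combℤ-nonneg-InS c c≥0 = (λ t → ∣ c t ∣) ,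
    sym (trans (pos-comb (λ t → ∣ c t ∣)) (combℤ-cong (λ t → 0≤i⇒+∣i∣≡i (c≥0 t))))

  label-minus-d₀-InS : ∀ (μ₁ μ₂ μ₃ : ℤ) m →
    μ₁ * + d₁ + μ₂ * + d₂ + μ₃ * + d₃ ≡ + (suc m ℕ.* d₀) →
    ∀ i j k → μ₁ ≤ + i → μ₂ ≤ + j → μ₃ ≤ + k →
    InS d (+ label d i j k - + d₀)
  label-minus-d₀-InS μ₁ μ₂ μ₃ m relation i j k μ₁≤i μ₂≤j μ₃≤k =
    subst (InS d) combℤ≡label-d₀ (combℤ-nonneg-InS c c≥0)
    where
    c : Fin 4 → ℤ
    c = + m ∷ + i - μ₁ ∷ + j - μ₂ ∷ + k - μ₃ ∷ []
    c≥0 : ∀ t → + 0 ≤ c t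
    c≥0 zero                   = +≤+ ℕ.z≤n
    c≥0 (suc zero)             = i≤j⇒0≤j-i μ₁≤i
    c≥0 (suc (suc zero))       = i≤j⇒0≤j-i μ₂≤j
    c≥0 (suc (suc (suc zero))) = i≤j⇒0≤j-i μ₃≤k
    combℤ≡label-d₀ : combℤ c ≡ + label d i j k - + d₀
    combℤ≡label-d₀ =
      trans (shift-by-relation (+ m) (+ d₀) (+ d₁) (+ d₂) (+ d₃) (+ i) (+ j) (+ k) μ₁ μ₂ μ₃
              (trans relation (pos-* (suc m) d₀)))
            (cong (_- + d₀) (sym (pos-label i j k)))

lemma2p1 : (d : Gens) → gcd4 d ≡ 1 → MinimalGens d →
    (μ₁ μ₂ μ₃ : ℤ) (μ : ℕ) → Data.Nat._<_ 0 μ →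
    μ₁ * + d (suc zero) + μ₂ * + d (suc (suc zero)) + μ₃ * + d (suc (suc (suc zero))) ≡ + (Data.Nat._*_ μ (d zero)) →
    (i j k : ℕ) → μ₁ ≤ + i → μ₂ ≤ + j → μ₃ ≤ + k →
    ¬ InAp d (+ label d i j k)
lemma2p1 d _ _ μ₁ μ₂ μ₃ (suc m) _ relation i j k μ₁≤i μ₂≤j μ₃≤k (_ , label-d₀∉S) =
  label-d₀∉S (label-minus-d₀-InS d μ₁ μ₂ μ₃ m relation i j k μ₁≤i μ₂≤j μ₃≤k)
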